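{- The $\mathbb{Q}$-module $\mathrm{GSym}$ is a subalgebra of $\mathbb{Q}[[X]]$, and for any upper left weak bicompositions $\binom{\alpha}{\beta}$, $\binom{\alpha'}{\beta'}$, $$\widehat{M}_{\binom{\alpha}{\beta}}\widehat{M}_{\binom{\alpha'}{\beta'}}=\widehat{M}_{\binom{\alpha}{\beta}*\binom{\alpha'}{\beta'}},$$ where $*$ is the quasi-shuffle product of bicompositions and $\widehat{M}$ is extended linearly.
   Context: $X=\{x_1,x_2,\dots\}$. An upper left weak bicomposition is a matrix $\binom{\alpha}{\beta}=\binom{\alpha_1,\dots,\alpha_k}{\beta_1,\dots,\beta_k}$ with $\alpha,\beta$ sequences of nonnegative integers and $\alpha_k>0$; $\widehat{M}_{\binom{\alpha}{\beta}}=\sum_{0<i_1<\dots<i_k}i_1^{\beta_1}\cdots i_k^{\beta_k}x_{i_1}^{\alpha_1}\cdots x_{i_k}^{\alpha_k}$ ($i^0=1$); $\mathrm{GSym}$ is the $\mathbb{Q}$-span of these in $\mathbb{Q}[[X]]$. Quasi-shuffle product of sequences of columns $a_i,b_i\in\mathbb{N}\times\mathbb{N}$ (added componentwise): bilinear, unit $\emptyset$, $(a_1,\dots,a_m)*(b_1,\dots,b_n)=(a_1,(a_2,\dots,a_m)*b)+(b_1,a*(b_2,\dots,b_n))+(a_1+b_1,(a_2,\dots,a_m)*(b_2,\dots,b_n))$, $(c,\sum\lambda_uu)=\sum\lambda_u(c,u)$. -}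

module Defs where

open import Data.Nat as ℕ using (ℕ; zero; suc; _<_; _≟_; _^_)
open import Data.Integer using (+_)
open import Data.Rational using (ℚ; 0ℚ; 1ℚ; _+_; _*_; _/_)
open import Data.List using (List; []; _∷_; map; _++_; concatMap; upTo; foldr)
open import Data.List.Relation.Unary.All using (All)
open import Data.Product using (_×_; _,_; proj₁; proj₂; Σ)
open import Data.Unit using (⊤)
open import Relation.Nullary using (yes; no)
open import Relation.Binary.PropositionalEquality using (_≡_)

-- A column (α_j , β_j) ∈ ℕ × ℕ; a (weak) bicomposition is a list of columns.
Column : Set
Column = ℕ × ℕ

Bicomp : Set
Bicomp = List Column

ULW : Bicomp → Set
ULW []           = ⊤
ULW (c ∷ [])     = 0 < proj₁ c
ULW (c ∷ d ∷ r)  = ULW (d ∷ r)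

_⊕_ : Column → Column → Column
(a , b) ⊕ (c , d) = (a ℕ.+ c , b ℕ.+ d)

-- Quasi-shuffle product; the result is a formal sum of words with
-- coefficient 1 each, represented as a list (with multiplicities).
qsh : Bicomp → Bicomp → List Bicomp
qsh [] v = v ∷ []
qsh (a ∷ u) [] = (a ∷ u) ∷ []
qsh (a ∷ u) (b ∷ v) =
  map (a ∷_) (qsh u (b ∷ v)) ++ map (b ∷_) (qsh (a ∷ u) v) ++ map ((a ⊕ b) ∷_) (qsh u v)

-- Formal power series in x_1, x_2, ... over ℚ: a monomial x_1^{e_1} x_2^{e_2} ⋯ x_n^{e_n}
-- is encoded by the list of exponents e_1 ∷ … ∷ e_n (trailing zeros allowed);
-- a power series is its coefficient function.
Monomial : Set
Monomial = List ℕ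

PS : Set
PS = Monomial → ℚ

_≈_ : PS → PS → Set
f ≈ g = ∀ m → f m ≡ g m

ℕ→ℚ : ℕ → ℚ
ℕ→ℚ n = + n / 1

allZero : Monomial → ℚ
allZero []          = 1ℚ
allZero (zero ∷ m)  = allZero m
allZero (suc _ ∷ m) = 0ℚ

onePS : PS
onePS = allZero

_+PS_ : PS → PS → PS
(f +PS g) m = f m + g m

zeroPS : PS
zeroPS _ = 0ℚ

splits : Monomial → List (Monomial × Monomial)
splits [] = ([] , []) ∷ []
splits (e ∷ m) =
  concatMap (λ k → map (λ pq → (k ∷ proj₁ pq , (e ℕ.∸ k) ∷ proj₂ pq)) (splits m))
            (upTo (suc e))

sumℚ : List ℚ → ℚ
sumℚ = foldr _+_ 0ℚ

_·_ : PS → PS → PS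
(f · g) m = sumℚ (map (λ pq → f (proj₁ pq) * g (proj₂ pq)) (splits m))

-- go b m i = coefficient of the monomial x_i^{e_1} x_{i+1}^{e_2} ⋯ (m = e_1 ∷ e_2 ∷ …)
-- in  Σ_{i ≤ i_1 < ⋯ < i_k} i_1^{β_1} ⋯ i_k^{β_k} x_{i_1}^{α_1} ⋯ x_{i_k}^{α_k}.
-- (Finite for upper left weak b, since α_k > 0 forces i_k into the support.)
go : Bicomp → Monomial → ℕ → ℚ
go [] m i = allZero m
go (_ ∷ _) [] i = 0ℚ
go ((a , β) ∷ b) (e ∷ m) i = chosen e + skipped e
  where
  chosen : ℕ → ℚ
  chosen e with e ≟ a
  ... | yes _ = ℕ→ℚ (i ^ β) * go b m (suc i)
  ... | no  _ = 0ℚ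
  skipped : ℕ → ℚ
  skipped zero    = go ((a , β) ∷ b) m (suc i)
  skipped (suc _) = 0ℚ

M̂ : Bicomp → PS
M̂ b m = go b m 1

M̂lin : List (ℚ × Bicomp) → PS
M̂lin L m = sumℚ (map (λ cb → proj₁ cb * M̂ (proj₂ cb) m) L)

M̂sum : List Bicomp → PS
M̂sum L m = sumℚ (map (λ b → M̂ b m) L)

InGSym : PS → Set
InGSym f = Σ (List (ℚ × Bicomp)) λ L → All (λ cb → ULW (proj₂ cb)) L × (f ≈ M̂lin L)

-- Compare coefficients one variable at a time. In its first variable x_i, the shifted series
-- M̂ᵢ i b is  x_i^{α₁} i^{β₁} M̂ᵢ (i+1) (tail b) + M̂ᵢ (i+1) b,  according as the first column of b
-- sits at index i or later. Multiplying two such decompositions gives four terms whose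
-- x_i-exponents add; the quasi-shuffle recursion produces the same four terms (the word starts
-- with a column of b, of b′, with their sum, or not at index i at all), because
-- i^β i^β′ = i^(β+β′). Induction on the monomial identifies the product with the quasi-shuffle,
-- and bilinearity then closes GSym under products.
module Submission where

open import Defs
open import Algebra using (CommutativeMonoid)
open import Data.Empty using (⊥)
open import Data.List using (List; []; _∷_; map; _++_; concatMap; upTo)
open import Data.List.Properties using (map-applyUpTo)
open import Data.List.Relation.Unary.All using (All; []; _∷_)
import Data.List.Relation.Unary.All as All
open import Data.List.Relation.Unary.All.Properties using (++⁺; map⁺; gmap⁺; concat⁺)
open import Data.Nat using (ℕ; zero; suc; _∸_; _^_; _≟_)
import Data.Nat as ℕ
import Data.Nat.Properties as ℕₚ
open import Data.Nat.Coprimality using (1-coprimeTo) renaming (sym to coprime-sym)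
import Data.Integer as ℤ
import Data.Integer.Properties as ℤₚ
open import Data.Product using (_×_; _,_; proj₁; proj₂)
open import Data.Rational using (ℚ; 0ℚ; 1ℚ; _+_; _*_; mkℚ)
import Data.Rational as ℚ
open import Data.Rational.Properties
  using ( +-identityˡ; +-identityʳ; +-assoc; *-assoc; *-identityˡ; *-zeroˡ; *-zeroʳ
        ; *-distribˡ-+; *-distribʳ-+; +-0-commutativeMonoid; normalize-coprime)
open import Algebra.Properties.CommutativeSemigroup
  (CommutativeMonoid.commutativeSemigroup +-0-commutativeMonoid) using (interchange)
open import Data.Rational.Solver using (module +-*-Solver)
open +-*-Solver using (solve; _:=_; _:+_; _:*_; con)
open import Data.Unit using (tt)
open import Function using (_∘_)
open import Relation.Binary.PropositionalEquality
open import Relation.Nullary using (yes; no; ¬_)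

private variable
  A B : Set

∑ : List A → (A → ℚ) → ℚ
∑ xs f = sumℚ (map f xs)

∑-cong : ∀ (xs : List A) {f g : A → ℚ} → (∀ x → f x ≡ g x) → ∑ xs f ≡ ∑ xs g
∑-cong []       f≡g = refl
∑-cong (x ∷ xs) f≡g = cong₂ _+_ (f≡g x) (∑-cong xs f≡g)

∑-++ : ∀ (xs ys : List A) (f : A → ℚ) → ∑ (xs ++ ys) f ≡ ∑ xs f + ∑ ys f
∑-++ []       ys f = sym (+-identityˡ _)
∑-++ (x ∷ xs) ys f = trans (cong (f x +_) (∑-++ xs ys f)) (sym (+-assoc (f x) _ _))

∑-map : ∀ (g : A → B) xs (f : B → ℚ) → ∑ (map g xs) f ≡ ∑ xs (f ∘ g)
∑-map g []       f = refl
∑-map g (x ∷ xs) f = cong (f (g x) +_) (∑-map g xs f)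

∑-concatMap : ∀ (g : A → List B) xs (f : B → ℚ) → ∑ (concatMap g xs) f ≡ ∑ xs (λ x → ∑ (g x) f)
∑-concatMap g []       f = refl
∑-concatMap g (x ∷ xs) f = trans (∑-++ (g x) _ f) (cong (∑ (g x) f +_) (∑-concatMap g xs f))

∑-zero : ∀ (xs : List A) → ∑ xs (λ _ → 0ℚ) ≡ 0ℚ
∑-zero []       = refl
∑-zero (x ∷ xs) = trans (+-identityˡ _) (∑-zero xs)

∑-distrib-+ : ∀ (xs : List A) (f g : A → ℚ) → ∑ xs (λ x → f x + g x) ≡ ∑ xs f + ∑ xs g
∑-distrib-+ []       f g = sym (+-identityˡ 0ℚ)
∑-distrib-+ (x ∷ xs) f g =
  trans (cong (f x + g x +_) (∑-distrib-+ xs f g)) (interchange (f x) (g x) _ _)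

*-distribˡ-∑ : ∀ c (xs : List A) (f : A → ℚ) → c * ∑ xs f ≡ ∑ xs (λ x → c * f x)
*-distribˡ-∑ c []       f = *-zeroʳ c
*-distribˡ-∑ c (x ∷ xs) f = trans (*-distribˡ-+ c (f x) _) (cong (c * f x +_) (*-distribˡ-∑ c xs f))

*-distribʳ-∑ : ∀ c (xs : List A) (f : A → ℚ) → ∑ xs f * c ≡ ∑ xs (λ x → f x * c)
*-distribʳ-∑ c []       f = *-zeroˡ c
*-distribʳ-∑ c (x ∷ xs) f = trans (*-distribʳ-+ c (f x) _) (cong (f x * c +_) (*-distribʳ-∑ c xs f))

∑-comm : ∀ (xs : List A) (ys : List B) (f : A → B → ℚ) →
         ∑ xs (λ x → ∑ ys (f x)) ≡ ∑ ys (λ y → ∑ xs (λ x → f x y))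
∑-comm []       ys f = sym (∑-zero ys)
∑-comm (x ∷ xs) ys f =
  trans (cong (∑ ys (f x) +_) (∑-comm xs ys f)) (sym (∑-distrib-+ ys (f x) _))

∑-*-∑ : ∀ (xs : List A) (ys : List B) f g → ∑ xs f * ∑ ys g ≡ ∑ xs (λ x → ∑ ys (λ y → f x * g y))
∑-*-∑ xs ys f g =
  trans (*-distribʳ-∑ _ xs f) (∑-cong xs (λ x → *-distribˡ-∑ (f x) ys g))

∑-upTo-suc : ∀ n (f : ℕ → ℚ) → ∑ (upTo (suc n)) f ≡ f 0 + ∑ (upTo n) (f ∘ suc)
∑-upTo-suc n f =
  cong (λ xs → f 0 + sumℚ xs) (trans (map-applyUpTo suc f n) (sym (map-applyUpTo (λ k → k) (f ∘ suc) n)))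

δ : ℕ → ℕ → ℚ
δ zero    zero    = 1ℚ
δ zero    (suc _) = 0ℚ
δ (suc _) zero    = 0ℚ
δ (suc k) (suc a) = δ k a

δ-refl-* : ∀ k x → δ k k * x ≡ x
δ-refl-* zero    x = *-identityˡ x
δ-refl-* (suc k) x = δ-refl-* k x

δ-≢-* : ∀ k a → ¬ k ≡ a → ∀ x → δ k a * x ≡ 0ℚ
δ-≢-* zero    zero    k≢a x with () ← k≢a refl
δ-≢-* zero    (suc a) k≢a x = *-zeroˡ x
δ-≢-* (suc k) zero    k≢a x = *-zeroˡ x
δ-≢-* (suc k) (suc a) k≢a x = δ-≢-* k a (k≢a ∘ cong suc) x

δ-convolution : ∀ e a a′ → ∑ (upTo (suc e)) (λ k → δ k a * δ (e ∸ k) a′) ≡ δ e (a ℕ.+ a′)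
δ-convolution e zero a′ =
  trans (∑-upTo-suc e (λ k → δ k 0 * δ (e ∸ k) a′))
    (trans (cong₂ _+_ (*-identityˡ (δ e a′))
                      (trans (∑-cong (upTo e) (λ k → *-zeroˡ (δ (e ∸ suc k) a′))) (∑-zero (upTo e))))
           (+-identityʳ (δ e a′)))
δ-convolution zero (suc a) a′ = trans (+-identityʳ _) (*-zeroˡ (δ 0 a′))
δ-convolution (suc e) (suc a) a′ =
  trans (∑-upTo-suc (suc e) (λ k → δ k (suc a) * δ (suc e ∸ k) a′))
    (trans (cong₂ _+_ (*-zeroˡ (δ (suc e) a′)) (δ-convolution e a a′)) (+-identityˡ _))

infixr 30 _⋆_

_⋆_ : ℚ → PS → PS
(c ⋆ f) m = c * f m

·-cong : ∀ {f f′ g g′} → f ≈ f′ → g ≈ g′ → (f · g) ≈ (f′ · g′)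
·-cong f≈f′ g≈g′ m = ∑-cong (splits m) (λ (p , q) → cong₂ _*_ (f≈f′ p) (g≈g′ q))

·-distribʳ-+PS : ∀ f f′ g m → ((f +PS f′) · g) m ≡ (f · g) m + (f′ · g) m
·-distribʳ-+PS f f′ g m =
  trans (∑-cong (splits m) (λ (p , q) → *-distribʳ-+ (g q) (f p) (f′ p))) (∑-distrib-+ (splits m) _ _)

·-distribˡ-+PS : ∀ f g g′ m → (f · (g +PS g′)) m ≡ (f · g) m + (f · g′) m
·-distribˡ-+PS f g g′ m =
  trans (∑-cong (splits m) (λ (p , q) → *-distribˡ-+ (f p) (g q) (g′ q))) (∑-distrib-+ (splits m) _ _)

⋆-·ˡ : ∀ c f g m → ((c ⋆ f) · g) m ≡ c * (f · g) m
⋆-·ˡ c f g m =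
  trans (∑-cong (splits m) (λ (p , q) → *-assoc c (f p) (g q))) (sym (*-distribˡ-∑ c (splits m) _))

⋆-·ʳ : ∀ c f g m → (f · (c ⋆ g)) m ≡ c * (f · g) m
⋆-·ʳ c f g m = trans (∑-cong (splits m) swap) (sym (*-distribˡ-∑ c (splits m) _))
  where
  swap : ∀ ((p , q) : Monomial × Monomial) → f p * (c * g q) ≡ c * (f p * g q)
  swap (p , q) = solve 3 (λ x y z → y :* (x :* z) := x :* (y :* z)) refl c (f p) (g q)

⋆-·-⋆ : ∀ c d f g m → ((c ⋆ f) · (d ⋆ g)) m ≡ (c * d) * (f · g) m
⋆-·-⋆ c d f g m = begin
  ((c ⋆ f) · (d ⋆ g)) m  ≡⟨ ⋆-·ˡ c f (d ⋆ g) m ⟩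
  c * (f · (d ⋆ g)) m    ≡⟨ cong (c *_) (⋆-·ʳ d f g m) ⟩
  c * (d * (f · g) m)    ≡⟨ *-assoc c d _ ⟨
  (c * d) * (f · g) m    ∎
  where open ≡-Reasoning

·-bilinear : ∀ c d c′ d′ f f′ g g′ m →
  ((c ⋆ f +PS d ⋆ f′) · (c′ ⋆ g +PS d′ ⋆ g′)) m
    ≡ (c * c′) * (f · g) m + (c * d′) * (f · g′) m + ((d * c′) * (f′ · g) m + (d * d′) * (f′ · g′) m)
·-bilinear c d c′ d′ f f′ g g′ m = begin
  ((c ⋆ f +PS d ⋆ f′) · h) m
    ≡⟨ ·-distribʳ-+PS (c ⋆ f) (d ⋆ f′) h m ⟩
  ((c ⋆ f) · h) m + ((d ⋆ f′) · h) m
    ≡⟨ cong₂ _+_ (·-distribˡ-+PS (c ⋆ f) (c′ ⋆ g) (d′ ⋆ g′) m)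
                 (·-distribˡ-+PS (d ⋆ f′) (c′ ⋆ g) (d′ ⋆ g′) m) ⟩
  ((c ⋆ f) · (c′ ⋆ g)) m + ((c ⋆ f) · (d′ ⋆ g′)) m + (((d ⋆ f′) · (c′ ⋆ g)) m + ((d ⋆ f′) · (d′ ⋆ g′)) m)
    ≡⟨ cong₂ _+_ (cong₂ _+_ (⋆-·-⋆ c c′ f g m) (⋆-·-⋆ c d′ f g′ m))
                 (cong₂ _+_ (⋆-·-⋆ d c′ f′ g m) (⋆-·-⋆ d d′ f′ g′ m)) ⟩
  (c * c′) * (f · g) m + (c * d′) * (f · g′) m + ((d * c′) * (f′ · g) m + (d * d′) * (f′ · g′) m) ∎
  where
  open ≡-Reasoning
  h = c′ ⋆ g +PS d′ ⋆ g′

·-distrib-∑ : ∀ (xs : List A) (ys : List B) (F : A → PS) (G : B → PS) m →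
  ((λ p → ∑ xs (λ x → F x p)) · (λ q → ∑ ys (λ y → G y q))) m ≡ ∑ xs (λ x → ∑ ys (λ y → (F x · G y) m))
·-distrib-∑ xs ys F G m = begin
  ∑ (splits m) (λ (p , q) → ∑ xs (λ x → F x p) * ∑ ys (λ y → G y q))
    ≡⟨ ∑-cong (splits m) (λ (p , q) → ∑-*-∑ xs ys (λ x → F x p) (λ y → G y q)) ⟩
  ∑ (splits m) (λ (p , q) → ∑ xs (λ x → ∑ ys (λ y → F x p * G y q)))
    ≡⟨ ∑-comm (splits m) xs _ ⟩
  ∑ xs (λ x → ∑ (splits m) (λ (p , q) → ∑ ys (λ y → F x p * G y q)))
    ≡⟨ ∑-cong xs (λ x → ∑-comm (splits m) ys _) ⟩
  ∑ xs (λ x → ∑ ys (λ y → (F x · G y) m)) ∎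
  where open ≡-Reasoning

·-cons : ∀ f g e m →
  (f · g) (e ∷ m) ≡ ∑ (upTo (suc e)) (λ k → ((λ p → f (k ∷ p)) · (λ q → g ((e ∸ k) ∷ q))) m)
·-cons f g e m =
  trans (∑-concatMap (λ k → map (shift k) (splits m)) (upTo (suc e)) product)
        (∑-cong (upTo (suc e)) (λ k → ∑-map (shift k) (splits m) product))
  where
  shift : ℕ → Monomial × Monomial → Monomial × Monomial
  shift k (p , q) = k ∷ p , (e ∸ k) ∷ q
  product : Monomial × Monomial → ℚ
  product (p , q) = f p * g q

FirstVarForm : PS → ℕ → PS → PS → Set
FirstVarForm f a F F′ = ∀ k → (λ p → f (k ∷ p)) ≈ (δ k a ⋆ F +PS δ k 0 ⋆ F′)

FirstVarForm-· : ∀ {f a F F′ g a′ G G′} → FirstVarForm f a F F′ → FirstVarForm g a′ G G′ → ∀ e m →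
  (f · g) (e ∷ m)
    ≡ δ e (a ℕ.+ a′) * (F · G) m + δ e a * (F · G′) m + (δ e a′ * (F′ · G) m + δ e 0 * (F′ · G′) m)
FirstVarForm-· {f} {a} {F} {F′} {g} {a′} {G} {G′} f≈ g≈ e m = begin
  (f · g) (e ∷ m)
    ≡⟨ ·-cons f g e m ⟩
  ∑ ks (λ k → ((λ p → f (k ∷ p)) · (λ q → g ((e ∸ k) ∷ q))) m)
    ≡⟨ ∑-cong ks (λ k → trans (·-cong (f≈ k) (g≈ (e ∸ k)) m)
                              (·-bilinear (δ k a) (δ k 0) (δ (e ∸ k) a′) (δ (e ∸ k) 0) F F′ G G′ m)) ⟩
  ∑ ks (λ k → t₁ k + t₂ k + (t₃ k + t₄ k))
    ≡⟨ ∑-distrib-+ ks (λ k → t₁ k + t₂ k) (λ k → t₃ k + t₄ k) ⟩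
  ∑ ks (λ k → t₁ k + t₂ k) + ∑ ks (λ k → t₃ k + t₄ k)
    ≡⟨ cong₂ _+_ (∑-distrib-+ ks t₁ t₂) (∑-distrib-+ ks t₃ t₄) ⟩
  ∑ ks t₁ + ∑ ks t₂ + (∑ ks t₃ + ∑ ks t₄)
    ≡⟨ cong₂ _+_ (cong₂ _+_ (convolve a a′ (F · G))
                            (trans (convolve a 0 (F · G′)) (cong (λ n → δ e n * _) (ℕₚ.+-identityʳ a))))
                 (cong₂ _+_ (convolve 0 a′ (F′ · G)) (convolve 0 0 (F′ · G′))) ⟩
  δ e (a ℕ.+ a′) * (F · G) m + δ e a * (F · G′) m + (δ e a′ * (F′ · G) m + δ e 0 * (F′ · G′) m) ∎
  where
  open ≡-Reasoning
  ks = upTo (suc e)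
  term : ℕ → ℕ → PS → ℕ → ℚ
  term b b′ H k = (δ k b * δ (e ∸ k) b′) * H m
  t₁ = term a a′ (F · G)
  t₂ = term a 0 (F · G′)
  t₃ = term 0 a′ (F′ · G)
  t₄ = term 0 0 (F′ · G′)
  convolve : ∀ b b′ H → ∑ ks (term b b′ H) ≡ δ e (b ℕ.+ b′) * H m
  convolve b b′ H =
    trans (sym (*-distribʳ-∑ (H m) ks (λ k → δ k b * δ (e ∸ k) b′))) (cong (_* H m) (δ-convolution e b b′))

-- The empty bicomposition is given weight 0: its series has no part of positive degree in the
-- first variable, which lets it share the decomposition of the nonempty ones.
leadExp : Bicomp → ℕ
leadExp []            = 0
leadExp ((a , _) ∷ _) = a

leadWeight : Bicomp → ℕ → ℚ
leadWeight []            i = 0ℚ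
leadWeight ((_ , β) ∷ _) i = ℕ→ℚ (i ^ β)

tail : Bicomp → Bicomp
tail []      = []
tail (_ ∷ b) = b

M̂ᵢ : ℕ → Bicomp → PS
M̂ᵢ i b m = go b m i

M̂ᵢ-FirstVarForm : ∀ b i → FirstVarForm (M̂ᵢ i b) (leadExp b) (leadWeight b i ⋆ M̂ᵢ (suc i) (tail b)) (M̂ᵢ (suc i) b)
M̂ᵢ-FirstVarForm [] i zero p = sym (begin
  δ 0 0 * (0ℚ * allZero p) + δ 0 0 * allZero p ≡⟨ cong₂ _+_ (δ-refl-* 0 (0ℚ * allZero p)) (δ-refl-* 0 (allZero p)) ⟩
  0ℚ * allZero p + allZero p                   ≡⟨ cong (_+ allZero p) (*-zeroˡ (allZero p)) ⟩
  0ℚ + allZero p                               ≡⟨ +-identityˡ (allZero p) ⟩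
  allZero p                                    ∎)
  where open ≡-Reasoning
M̂ᵢ-FirstVarForm [] i (suc k) p =
  sym (cong₂ _+_ (δ-≢-* (suc k) 0 (λ ()) (0ℚ * allZero p)) (δ-≢-* (suc k) 0 (λ ()) (allZero p)))
M̂ᵢ-FirstVarForm ((a , β) ∷ b) i k p with k ≟ a
M̂ᵢ-FirstVarForm ((a , β) ∷ b) i zero p    | yes refl =
  sym (cong₂ _+_ (δ-refl-* 0 (ℕ→ℚ (i ^ β) * M̂ᵢ (suc i) b p)) (δ-refl-* 0 (M̂ᵢ (suc i) ((0 , β) ∷ b) p)))
M̂ᵢ-FirstVarForm ((a , β) ∷ b) i (suc k) p | yes refl =
  sym (cong₂ _+_ (δ-refl-* (suc k) (ℕ→ℚ (i ^ β) * M̂ᵢ (suc i) b p))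
                 (δ-≢-* (suc k) 0 (λ ()) (M̂ᵢ (suc i) ((suc k , β) ∷ b) p)))
M̂ᵢ-FirstVarForm ((a , β) ∷ b) i zero p    | no k≢a =
  sym (cong₂ _+_ (δ-≢-* 0 a k≢a (ℕ→ℚ (i ^ β) * M̂ᵢ (suc i) b p)) (δ-refl-* 0 (M̂ᵢ (suc i) ((a , β) ∷ b) p)))
M̂ᵢ-FirstVarForm ((a , β) ∷ b) i (suc k) p | no k≢a =
  sym (cong₂ _+_ (δ-≢-* (suc k) a k≢a (ℕ→ℚ (i ^ β) * M̂ᵢ (suc i) b p))
                 (δ-≢-* (suc k) 0 (λ ()) (M̂ᵢ (suc i) ((a , β) ∷ b) p)))

-- The recursion in the exponent e of x_i obeyed both by the product and by the quasi-shuffle sum.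
firstVarStep : (Bicomp → Bicomp → ℚ) → ℕ → ℕ → Bicomp → Bicomp → ℚ
firstVarStep P e i b b′ =
    δ e (leadExp b ℕ.+ leadExp b′) * ((leadWeight b i * leadWeight b′ i) * P (tail b) (tail b′))
  + δ e (leadExp b) * (leadWeight b i * P (tail b) b′)
  + (δ e (leadExp b′) * (leadWeight b′ i * P b (tail b′)) + δ e 0 * P b b′)

firstVarStep-cong : ∀ {P Q} → (∀ u v → P u v ≡ Q u v) → ∀ e i b b′ →
                    firstVarStep P e i b b′ ≡ firstVarStep Q e i b b′
firstVarStep-cong P≡Q e i b b′ =
  cong₂ _+_ (cong₂ _+_ (cong (λ x → δ e (leadExp b ℕ.+ leadExp b′) * ((c * c′) * x)) (P≡Q (tail b) (tail b′)))
                       (cong (λ x → δ e (leadExp b) * (c * x)) (P≡Q (tail b) b′)))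
            (cong₂ _+_ (cong (λ x → δ e (leadExp b′) * (c′ * x)) (P≡Q b (tail b′)))
                       (cong (δ e 0 *_) (P≡Q b b′)))
  where
  c = leadWeight b i
  c′ = leadWeight b′ i

M̂ᵢ-·-step : ∀ b b′ i e m →
  (M̂ᵢ i b · M̂ᵢ i b′) (e ∷ m) ≡ firstVarStep (λ u v → (M̂ᵢ (suc i) u · M̂ᵢ (suc i) v) m) e i b b′
M̂ᵢ-·-step b b′ i e m =
  trans (FirstVarForm-· {f = M̂ᵢ i b} {g = M̂ᵢ i b′} (M̂ᵢ-FirstVarForm b i) (M̂ᵢ-FirstVarForm b′ i) e m)
        (cong₂ _+_ (cong₂ _+_ (cong (δ e (leadExp b ℕ.+ leadExp b′) *_) (⋆-·-⋆ c c′ tl tl′ m))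
                              (cong (δ e (leadExp b) *_) (⋆-·ˡ c tl rest′ m)))
                   (cong (_+ δ e 0 * (rest · rest′) m) (cong (δ e (leadExp b′) *_) (⋆-·ʳ c′ rest tl′ m))))
  where
  c = leadWeight b i
  c′ = leadWeight b′ i
  tl = M̂ᵢ (suc i) (tail b)
  tl′ = M̂ᵢ (suc i) (tail b′)
  rest = M̂ᵢ (suc i) b
  rest′ = M̂ᵢ (suc i) b′

ℕ→ℚ-mkℚ : ∀ n → ℕ→ℚ n ≡ mkℚ (ℤ.+ n) 0 (coprime-sym (1-coprimeTo n))
ℕ→ℚ-mkℚ n = normalize-coprime (coprime-sym (1-coprimeTo n))

ℕ→ℚ-* : ∀ m n → ℕ→ℚ (m ℕ.* n) ≡ ℕ→ℚ m * ℕ→ℚ n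
ℕ→ℚ-* m n rewrite ℕ→ℚ-mkℚ m | ℕ→ℚ-mkℚ n = cong (ℚ._/ 1) (ℤₚ.pos-* m n)

ℕ→ℚ-^-+ : ∀ i β β′ → ℕ→ℚ (i ^ (β ℕ.+ β′)) ≡ ℕ→ℚ (i ^ β) * ℕ→ℚ (i ^ β′)
ℕ→ℚ-^-+ i β β′ = trans (cong ℕ→ℚ (ℕₚ.^-distribˡ-+-* i β β′)) (ℕ→ℚ-* (i ^ β) (i ^ β′))

qsh-[]ʳ : ∀ u → qsh u [] ≡ u ∷ []
qsh-[]ʳ []      = refl
qsh-[]ʳ (_ ∷ _) = refl

∑-qsh-∷ : ∀ a u b v (F : Bicomp → ℚ) →
  ∑ (qsh (a ∷ u) (b ∷ v)) F
    ≡ ∑ (qsh u (b ∷ v)) (F ∘ (a ∷_)) + (∑ (qsh (a ∷ u) v) (F ∘ (b ∷_)) + ∑ (qsh u v) (F ∘ ((a ⊕ b) ∷_)))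
∑-qsh-∷ a u b v F =
  trans (∑-++ (map (a ∷_) (qsh u (b ∷ v))) _ F)
    (cong₂ _+_ (∑-map (a ∷_) (qsh u (b ∷ v)) F)
      (trans (∑-++ (map (b ∷_) (qsh (a ∷ u) v)) _ F)
        (cong₂ _+_ (∑-map (b ∷_) (qsh (a ∷ u) v) F) (∑-map ((a ⊕ b) ∷_) (qsh u v) F))))

∑-M̂ᵢ-∷ : ∀ a β (L : List Bicomp) i e m →
  ∑ L (λ w → M̂ᵢ i ((a , β) ∷ w) (e ∷ m))
    ≡ δ e a * (ℕ→ℚ (i ^ β) * ∑ L (λ w → M̂ᵢ (suc i) w m)) + δ e 0 * ∑ L (λ w → M̂ᵢ (suc i) ((a , β) ∷ w) m)
∑-M̂ᵢ-∷ a β L i e m = begin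
  ∑ L (λ w → M̂ᵢ i ((a , β) ∷ w) (e ∷ m))
    ≡⟨ ∑-cong L (λ w → M̂ᵢ-FirstVarForm ((a , β) ∷ w) i e m) ⟩
  ∑ L (λ w → δ e a * (c * tl w) + δ e 0 * rest w)
    ≡⟨ ∑-distrib-+ L (λ w → δ e a * (c * tl w)) (λ w → δ e 0 * rest w) ⟩
  ∑ L (λ w → δ e a * (c * tl w)) + ∑ L (λ w → δ e 0 * rest w)
    ≡⟨ cong₂ _+_ (sym (*-distribˡ-∑ (δ e a) L (λ w → c * tl w))) (sym (*-distribˡ-∑ (δ e 0) L rest)) ⟩
  δ e a * ∑ L (λ w → c * tl w) + δ e 0 * ∑ L rest
    ≡⟨ cong (λ x → δ e a * x + δ e 0 * ∑ L rest) (sym (*-distribˡ-∑ c L tl)) ⟩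
  δ e a * (c * ∑ L tl) + δ e 0 * ∑ L rest ∎
  where
  open ≡-Reasoning
  c = ℕ→ℚ (i ^ β)
  tl = λ w → M̂ᵢ (suc i) w m
  rest = λ w → M̂ᵢ (suc i) ((a , β) ∷ w) m

M̂ᵢ-qsh-step : ∀ b b′ i e m →
  ∑ (qsh b b′) (λ w → M̂ᵢ i w (e ∷ m)) ≡ firstVarStep (λ u v → ∑ (qsh u v) (λ w → M̂ᵢ (suc i) w m)) e i b b′
M̂ᵢ-qsh-step [] b′ i e m =
  trans (cong (_+ 0ℚ) (M̂ᵢ-FirstVarForm b′ i e m))
        (rearrange (δ e (leadExp b′)) (δ e 0) (leadWeight b′ i) (M̂ᵢ (suc i) (tail b′) m) (M̂ᵢ (suc i) b′ m))
  where
  rearrange : ∀ d d₀ c t r →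
    (d * (c * t) + d₀ * r) + 0ℚ ≡ d * ((0ℚ * c) * (t + 0ℚ)) + d₀ * (0ℚ * (r + 0ℚ)) + (d * (c * (t + 0ℚ)) + d₀ * (r + 0ℚ))
  rearrange = solve 5 (λ d d₀ c t r →
    (d :* (c :* t) :+ d₀ :* r) :+ con 0ℚ
      := d :* ((con 0ℚ :* c) :* (t :+ con 0ℚ)) :+ d₀ :* (con 0ℚ :* (r :+ con 0ℚ))
         :+ (d :* (c :* (t :+ con 0ℚ)) :+ d₀ :* (r :+ con 0ℚ))) refl
M̂ᵢ-qsh-step ((a , β) ∷ u) [] i e m rewrite qsh-[]ʳ u =
  trans (cong (_+ 0ℚ) (M̂ᵢ-FirstVarForm ((a , β) ∷ u) i e m))
        (rearrange (δ e (a ℕ.+ 0)) (δ e a) (δ e 0) (ℕ→ℚ (i ^ β)) (M̂ᵢ (suc i) u m) (M̂ᵢ (suc i) ((a , β) ∷ u) m))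
  where
  rearrange : ∀ d dₐ d₀ c t r →
    (dₐ * (c * t) + d₀ * r) + 0ℚ ≡ d * ((c * 0ℚ) * (t + 0ℚ)) + dₐ * (c * (t + 0ℚ)) + (d₀ * (0ℚ * (r + 0ℚ)) + d₀ * (r + 0ℚ))
  rearrange = solve 6 (λ d dₐ d₀ c t r →
    (dₐ :* (c :* t) :+ d₀ :* r) :+ con 0ℚ
      := d :* ((c :* con 0ℚ) :* (t :+ con 0ℚ)) :+ dₐ :* (c :* (t :+ con 0ℚ))
         :+ (d₀ :* (con 0ℚ :* (r :+ con 0ℚ)) :+ d₀ :* (r :+ con 0ℚ))) refl
M̂ᵢ-qsh-step ((a , β) ∷ u) ((a′ , β′) ∷ v) i e m = begin
  ∑ (qsh (col ∷ u) (col′ ∷ v)) now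
    ≡⟨ ∑-qsh-∷ col u col′ v now ⟩
  ∑ X (now ∘ (col ∷_)) + (∑ Y (now ∘ (col′ ∷_)) + ∑ Z (now ∘ ((col ⊕ col′) ∷_)))
    ≡⟨ cong₂ _+_ (∑-M̂ᵢ-∷ a β X i e m) (cong₂ _+_ (∑-M̂ᵢ-∷ a′ β′ Y i e m) (∑-M̂ᵢ-∷ (a ℕ.+ a′) (β ℕ.+ β′) Z i e m)) ⟩
  (dₐ * (c * x) + d₀ * x′) + ((dₐ′ * (c′ * y) + d₀ * y′) + (d * (ℕ→ℚ (i ^ (β ℕ.+ β′)) * z) + d₀ * z′))
    ≡⟨ cong (λ w → (dₐ * (c * x) + d₀ * x′) + ((dₐ′ * (c′ * y) + d₀ * y′) + (d * (w * z) + d₀ * z′)))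
            (ℕ→ℚ-^-+ i β β′) ⟩
  (dₐ * (c * x) + d₀ * x′) + ((dₐ′ * (c′ * y) + d₀ * y′) + (d * ((c * c′) * z) + d₀ * z′))
    ≡⟨ rearrange d dₐ dₐ′ d₀ c c′ x y z x′ y′ z′ ⟩
  d * ((c * c′) * z) + dₐ * (c * x) + (dₐ′ * (c′ * y) + d₀ * (x′ + (y′ + z′)))
    ≡⟨ cong (λ w → d * ((c * c′) * z) + dₐ * (c * x) + (dₐ′ * (c′ * y) + d₀ * w)) (∑-qsh-∷ col u col′ v later) ⟨
  firstVarStep (λ u v → ∑ (qsh u v) later) e i (col ∷ u) (col′ ∷ v) ∎
  where
  open ≡-Reasoning
  col = (a , β)
  col′ = (a′ , β′)
  now = λ w → M̂ᵢ i w (e ∷ m)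
  later = λ w → M̂ᵢ (suc i) w m
  c = ℕ→ℚ (i ^ β)
  c′ = ℕ→ℚ (i ^ β′)
  d = δ e (a ℕ.+ a′)
  dₐ = δ e a
  dₐ′ = δ e a′
  d₀ = δ e 0
  X = qsh u (col′ ∷ v)
  Y = qsh (col ∷ u) v
  Z = qsh u v
  x = ∑ X later
  y = ∑ Y later
  z = ∑ Z later
  x′ = ∑ X (later ∘ (col ∷_))
  y′ = ∑ Y (later ∘ (col′ ∷_))
  z′ = ∑ Z (later ∘ ((col ⊕ col′) ∷_))
  rearrange : ∀ d dₐ dₐ′ d₀ c c′ x y z x′ y′ z′ →
    (dₐ * (c * x) + d₀ * x′) + ((dₐ′ * (c′ * y) + d₀ * y′) + (d * ((c * c′) * z) + d₀ * z′))
      ≡ d * ((c * c′) * z) + dₐ * (c * x) + (dₐ′ * (c′ * y) + d₀ * (x′ + (y′ + z′)))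
  rearrange = solve 12 (λ d dₐ dₐ′ d₀ c c′ x y z x′ y′ z′ →
    (dₐ :* (c :* x) :+ d₀ :* x′) :+ ((dₐ′ :* (c′ :* y) :+ d₀ :* y′) :+ (d :* ((c :* c′) :* z) :+ d₀ :* z′))
      := d :* ((c :* c′) :* z) :+ dₐ :* (c :* x) :+ (dₐ′ :* (c′ :* y) :+ d₀ :* (x′ :+ (y′ :+ z′)))) refl

M̂ᵢ-·-[] : ∀ b b′ i → (M̂ᵢ i b · M̂ᵢ i b′) [] ≡ ∑ (qsh b b′) (λ w → M̂ᵢ i w [])
M̂ᵢ-·-[] []      b′      i = cong (_+ 0ℚ) (*-identityˡ (M̂ᵢ i b′ []))
M̂ᵢ-·-[] (_ ∷ _) []      i = refl
M̂ᵢ-·-[] (a ∷ u) (b ∷ v) i =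
  sym (trans (∑-qsh-∷ a u b v (λ w → M̂ᵢ i w []))
             (cong₂ _+_ (∑-zero (qsh u (b ∷ v))) (cong₂ _+_ (∑-zero (qsh (a ∷ u) v)) (∑-zero (qsh u v)))))

M̂ᵢ-· : ∀ m b b′ i → (M̂ᵢ i b · M̂ᵢ i b′) m ≡ ∑ (qsh b b′) (λ w → M̂ᵢ i w m)
M̂ᵢ-· []      b b′ i = M̂ᵢ-·-[] b b′ i
M̂ᵢ-· (e ∷ m) b b′ i = begin
  (M̂ᵢ i b · M̂ᵢ i b′) (e ∷ m)
    ≡⟨ M̂ᵢ-·-step b b′ i e m ⟩
  firstVarStep (λ u v → (M̂ᵢ (suc i) u · M̂ᵢ (suc i) v) m) e i b b′
    ≡⟨ firstVarStep-cong (λ u v → M̂ᵢ-· m u v (suc i)) e i b b′ ⟩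
  firstVarStep (λ u v → ∑ (qsh u v) (λ w → M̂ᵢ (suc i) w m)) e i b b′
    ≡⟨ M̂ᵢ-qsh-step b b′ i e m ⟨
  ∑ (qsh b b′) (λ w → M̂ᵢ i w (e ∷ m)) ∎
  where open ≡-Reasoning

M̂-· : ∀ b b′ → (M̂ b · M̂ b′) ≈ M̂sum (qsh b b′)
M̂-· b b′ m = M̂ᵢ-· m b b′ 1

ULW⁺ : Bicomp → Set
ULW⁺ []      = ⊥
ULW⁺ (c ∷ w) = ULW (c ∷ w)

ULW⁺-∷ : ∀ a {w} → ULW⁺ w → ULW⁺ (a ∷ w)
ULW⁺-∷ a {_ ∷ _} h = h

ULW-tail : ∀ a u → ULW (a ∷ u) → ULW u
ULW-tail a []      _ = tt
ULW-tail a (_ ∷ _) h = h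

ULW⁺⇒ULW : ∀ {w} → ULW⁺ w → ULW w
ULW⁺⇒ULW {_ ∷ _} h = h

mutual
  qsh-ULW⁺ : ∀ u v → ULW⁺ u → ULW⁺ v → All ULW⁺ (qsh u v)
  qsh-ULW⁺ (a ∷ u) (b ∷ v) hu hv =
    ++⁺ (map⁺ (All.map (λ {w} → ULW⁺-∷ a {w}) (qsh-ULW⁺ˡ u (b ∷ v) (ULW-tail a u hu) hv)))
        (++⁺ (map⁺ (All.map (λ {w} → ULW⁺-∷ b {w}) (qsh-ULW⁺ʳ (a ∷ u) v hu (ULW-tail b v hv))))
             (qsh-ULW⁺-⊕ a b u v hu hv))

  qsh-ULW⁺ˡ : ∀ u v → ULW u → ULW⁺ v → All ULW⁺ (qsh u v)
  qsh-ULW⁺ˡ []      v _  hv = hv ∷ []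
  qsh-ULW⁺ˡ (c ∷ u) v hu hv = qsh-ULW⁺ (c ∷ u) v hu hv

  qsh-ULW⁺ʳ : ∀ u v → ULW⁺ u → ULW v → All ULW⁺ (qsh u v)
  qsh-ULW⁺ʳ (c ∷ u) []      hu _  = hu ∷ []
  qsh-ULW⁺ʳ u       (d ∷ v) hu hv = qsh-ULW⁺ u (d ∷ v) hu hv

  qsh-ULW⁺-⊕ : ∀ a b u v → ULW (a ∷ u) → ULW (b ∷ v) → All ULW⁺ (map ((a ⊕ b) ∷_) (qsh u v))
  qsh-ULW⁺-⊕ a b []      []      ha _  = ℕₚ.<-≤-trans ha (ℕₚ.m≤m+n (proj₁ a) (proj₁ b)) ∷ []
  qsh-ULW⁺-⊕ a b []      (d ∷ v) _  hv = hv ∷ []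
  qsh-ULW⁺-⊕ a b (c ∷ u) []      hu _  = hu ∷ []
  qsh-ULW⁺-⊕ a b (c ∷ u) (d ∷ v) hu hv =
    map⁺ (All.map (λ {w} → ULW⁺-∷ (a ⊕ b) {w}) (qsh-ULW⁺ (c ∷ u) (d ∷ v) hu hv))

qsh-ULW : ∀ b b′ → ULW b → ULW b′ → All ULW (qsh b b′)
qsh-ULW []      b′      _  h′ = h′ ∷ []
qsh-ULW (c ∷ u) []      h  _  = h ∷ []
qsh-ULW (c ∷ u) (d ∷ v) h  h′ = All.map (λ {w} → ULW⁺⇒ULW {w}) (qsh-ULW⁺ (c ∷ u) (d ∷ v) h h′)

LinComb : Set
LinComb = List (ℚ × Bicomp)

infixl 7 _⧢_

_⧢_ : LinComb → LinComb → LinComb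
L ⧢ L′ = concatMap (λ (c , b) → concatMap (λ (c′ , b′) → map (c * c′ ,_) (qsh b b′)) L′) L

AllULW : LinComb → Set
AllULW = All (ULW ∘ proj₂)

⧢-AllULW : ∀ {L L′} → AllULW L → AllULW L′ → AllULW (L ⧢ L′)
⧢-AllULW hL hL′ =
  concat⁺ (gmap⁺ (λ {(_ , b)} hb →
    concat⁺ (gmap⁺ (λ {(_ , b′)} hb′ → map⁺ (qsh-ULW b b′ hb hb′)) hL′)) hL)

M̂lin-++ : ∀ L L′ → (M̂lin L +PS M̂lin L′) ≈ M̂lin (L ++ L′)
M̂lin-++ L L′ m = sym (∑-++ L L′ (λ (c , b) → c * M̂ b m))

M̂lin-· : ∀ L L′ → (M̂lin L · M̂lin L′) ≈ M̂lin (L ⧢ L′)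
M̂lin-· L L′ m = begin
  (M̂lin L · M̂lin L′) m
    ≡⟨ ·-distrib-∑ L L′ (λ (c , b) → c ⋆ M̂ b) (λ (c′ , b′) → c′ ⋆ M̂ b′) m ⟩
  ∑ L (λ (c , b) → ∑ L′ (λ (c′ , b′) → ((c ⋆ M̂ b) · (c′ ⋆ M̂ b′)) m))
    ≡⟨ ∑-cong L (λ (c , b) → ∑-cong L′ (λ (c′ , b′) →
         trans (⋆-·-⋆ c c′ (M̂ b) (M̂ b′) m) (cong ((c * c′) *_) (M̂-· b b′ m)))) ⟩
  ∑ L (λ (c , b) → ∑ L′ (λ (c′ , b′) → (c * c′) * M̂sum (qsh b b′) m))
    ≡⟨ ∑-cong L (λ (c , b) → ∑-cong L′ (λ (c′ , b′) → *-distribˡ-∑ (c * c′) (qsh b b′) (λ w → M̂ w m))) ⟩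
  ∑ L (λ (c , b) → ∑ L′ (λ (c′ , b′) → ∑ (qsh b b′) (λ w → (c * c′) * M̂ w m)))
    ≡⟨ ∑-cong L (λ (c , b) → ∑-cong L′ (λ (c′ , b′) → ∑-map (c * c′ ,_) (qsh b b′) term)) ⟨
  ∑ L (λ (c , b) → ∑ L′ (λ (c′ , b′) → ∑ (map (c * c′ ,_) (qsh b b′)) term))
    ≡⟨ ∑-cong L (λ (c , b) → ∑-concatMap (λ (c′ , b′) → map (c * c′ ,_) (qsh b b′)) L′ term) ⟨
  ∑ L (λ (c , b) → ∑ (concatMap (λ (c′ , b′) → map (c * c′ ,_) (qsh b b′)) L′) term)
    ≡⟨ ∑-concatMap _ L term ⟨
  M̂lin (L ⧢ L′) m ∎
  where
  open ≡-Reasoning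
  term : ℚ × Bicomp → ℚ
  term (c , b) = c * M̂ b m

GSym-1 : InGSym onePS
GSym-1 = (1ℚ , []) ∷ [] , tt ∷ [] , λ m → sym (trans (+-identityʳ _) (*-identityˡ (allZero m)))

GSym-0 : InGSym zeroPS
GSym-0 = [] , [] , λ _ → refl

GSym-+ : ∀ f g → InGSym f → InGSym g → InGSym (f +PS g)
GSym-+ f g (L , hL , f≈) (L′ , hL′ , g≈) =
  L ++ L′ , ++⁺ hL hL′ , λ m → trans (cong₂ _+_ (f≈ m) (g≈ m)) (M̂lin-++ L L′ m)

GSym-· : ∀ f g → InGSym f → InGSym g → InGSym (f · g)
GSym-· f g (L , hL , f≈) (L′ , hL′ , g≈) =
  L ⧢ L′ , ⧢-AllULW hL hL′ , λ m → trans (·-cong f≈ g≈ m) (M̂lin-· L L′ m)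

-- The hypotheses ULW b, ULW b′ go unused: the coefficient identity holds for all bicompositions.
corollary2p5 :
    (InGSym onePS × InGSym zeroPS
      × (∀ f g → InGSym f → InGSym g → InGSym (f +PS g))
      × (∀ f g → InGSym f → InGSym g → InGSym (f · g)))
    × (∀ b b′ → ULW b → ULW b′ → (M̂ b · M̂ b′) ≈ M̂sum (qsh b b′))
corollary2p5 = (GSym-1 , GSym-0 , GSym-+ , GSym-·) , λ b b′ _ _ → M̂-· b b′
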